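{- (Shift removal, positive.) Let $A^+$ be a polarized positive proposition and $P$ an unpolarized proposition with $(A^+)^\bullet = P$. Then there exists a positive proposition $B^+$, not of the form ${\downarrow}{\uparrow}C^+$ for any $C^+$, such that $(B^+)^\bullet = P$ and, for every hypothetical context $\Gamma$, if $\Gamma;\cdot\vdash B^+$ is derivable then $\Gamma;\cdot\vdash A^+$ is derivable.
   Context: Unpolarized propositions: $P ::= p \mid \bot \mid P_1\vee P_2 \mid \top \mid P_1 \wedge P_2 \mid P_1 \supset P_2$. Polarized propositions (each atom has a fixed polarity): $A^+ ::= p^+ \mid {\downarrow}A^- \mid \bot \mid A^+\vee B^+ \mid \top^+ \mid A^+\wedge^+ B^+$; $A^- ::= p^- \mid {\uparrow}A^+ \mid A^+\supset B^- \mid \top^- \mid A^-\wedge^- B^-$. Erasure: $(p^\pm)^\bullet=p$, $({\downarrow}A^-)^\bullet=(A^-)^\bullet$, $({\uparrow}A^+)^\bullet=(A^+)^\bullet$, $\bot^\bullet=\bot$, $(\top^\pm)^\bullet=\top$, $(A\vee B)^\bullet=A^\bullet\vee B^\bullet$, $(A\wedge^\pm B)^\bullet=A^\bullet\wedge B^\bullet$, $(A^+\supset B^-)^\bullet=(A^+)^\bullet\supset(B^-)^\bullet$. Focused calculus: hypothetical contexts (multisets) $\Gamma ::= \cdot \mid \Gamma,A^- \mid \Gamma,\langle A^+\rangle$ ($\langle A^+\rangle$ a suspended positive proposition). Inversion contexts $\Omega$: ordered sequences of positive propositions. Succedents $U ::= [A^+] \mid A^+ \mid A^- \mid \langle A^-\rangle$;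 $U$ is stable iff of the form $A^+$ or $\langle A^-\rangle$. Three sequent forms: right focus $\Gamma\vdash[A^+]$; inversion $\Gamma;\Omega\vdash U$ ($U$ not of the form $[A^+]$); left focus $\Gamma;[A^-]\vdash U$ ($U$ stable). Rules. Right focus: $id^+$: $\Gamma,\langle A^+\rangle\vdash[A^+]$; ${\downarrow}_R$: from $\Gamma;\cdot\vdash A^-$ infer $\Gamma\vdash[{\downarrow}A^-]$; $\vee_{R1}$/$\vee_{R2}$: from $\Gamma\vdash[A^+]$ (resp. $[B^+]$) infer $\Gamma\vdash[A^+\vee B^+]$; $\top^+_R$: $\Gamma\vdash[\top^+]$; $\wedge^+_R$: from $\Gamma\vdash[A^+]$, $\Gamma\vdash[B^+]$ infer $\Gamma\vdash[A^+\wedge^+B^+]$. Inversion: $foc_R$: from $\Gamma\vdash[A^+]$ infer $\Gamma;\cdot\vdash A^+$; $foc_L$: from $\Gamma,A^-;[A^-]\vdash U$, $U$ stable, infer $\Gamma,A^-;\cdot\vdash U$; $\eta^+$: from $\Gamma,\langle p^+\rangle;\Omega\vdash U$ infer $\Gamma;p^+,\Omega\vdash U$; ${\downarrow}_L$: from $\Gamma,A^-;\Omega\vdash U$ infer $\Gamma;{\downarrow}A^-,\Omega\vdash U$; $\bot_L$: $\Gamma;\bot,\Omega\vdash U$; $\vee_L$: from $\Gamma;A^+,\Omega\vdash U$ and $\Gamma;B^+,\Omega\vdash U$ infer $\Gamma;A^+\vee B^+,\Omega\vdash U$; $\top^+_L$: from $\Gamma;\Omega\vdash U$ infer $\Gamma;\top^+,\Omega\vdash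 U$; $\wedge^+_L$: from $\Gamma;A^+,B^+,\Omega\vdash U$ infer $\Gamma;A^+\wedge^+B^+,\Omega\vdash U$; $\eta^-$: from $\Gamma;\cdot\vdash\langle p^-\rangle$ infer $\Gamma;\cdot\vdash p^-$; ${\uparrow}_R$: from $\Gamma;\cdot\vdash A^+$ infer $\Gamma;\cdot\vdash{\uparrow}A^+$; $\supset_R$: from $\Gamma;A^+\vdash B^-$ infer $\Gamma;\cdot\vdash A^+\supset B^-$; $\top^-_R$: $\Gamma;\cdot\vdash\top^-$; $\wedge^-_R$: from $\Gamma;\cdot\vdash A^-$ and $\Gamma;\cdot\vdash B^-$ infer $\Gamma;\cdot\vdash A^-\wedge^-B^-$. Left focus: $id^-$: $\Gamma;[A^-]\vdash\langle A^-\rangle$; ${\uparrow}_L$: from $\Gamma;A^+\vdash U$ infer $\Gamma;[{\uparrow}A^+]\vdash U$; $\supset_L$: from $\Gamma\vdash[A^+]$ and $\Gamma;[B^-]\vdash U$ infer $\Gamma;[A^+\supset B^-]\vdash U$; $\wedge^-_{L1}$/$\wedge^-_{L2}$: from $\Gamma;[A^-]\vdash U$ (resp. $[B^-]$) infer $\Gamma;[A^-\wedge^-B^-]\vdash U$. (No $\bot_R$, no $\top^-_L$.) -}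

module Defs where

open import Data.Nat using (ℕ)
open import Data.List using (List; []; _∷_)
open import Data.List.Membership.Propositional using (_∈_)

data Atom : Set where
  atom⁺ : ℕ → Atom
  atom⁻ : ℕ → Atom

infixr 5 _∨_
infixr 6 _∧_
infixr 4 _⊃_
data UProp : Set where
  at  : Atom → UProp
  ⊥′  : UProp
  _∨_ : UProp → UProp → UProp
  ⊤′  : UProp
  _∧_ : UProp → UProp → UProp
  _⊃_ : UProp → UProp → UProp

mutual
  data Pos : Set where
    p⁺   : ℕ → Pos
    ↓    : Neg → Pos
    ⊥⁺   : Pos
    _∨⁺_ : Pos → Pos → Pos
    ⊤⁺   : Pos
    _∧⁺_ : Pos → Pos → Pos

  data Neg : Set where
    p⁻   : ℕ → Neg
    ↑    : Pos → Neg
    _⊃⁻_ : Pos → Neg → Neg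
    ⊤⁻   : Neg
    _∧⁻_ : Neg → Neg → Neg

mutual
  ∣_∣⁺ : Pos → UProp
  ∣ p⁺ n ∣⁺     = at (atom⁺ n)
  ∣ ↓ A ∣⁺      = ∣ A ∣⁻
  ∣ ⊥⁺ ∣⁺       = ⊥′
  ∣ A ∨⁺ B ∣⁺   = ∣ A ∣⁺ ∨ ∣ B ∣⁺
  ∣ ⊤⁺ ∣⁺       = ⊤′
  ∣ A ∧⁺ B ∣⁺   = ∣ A ∣⁺ ∧ ∣ B ∣⁺

  ∣_∣⁻ : Neg → UProp
  ∣ p⁻ n ∣⁻     = at (atom⁻ n)
  ∣ ↑ A ∣⁻      = ∣ A ∣⁺
  ∣ A ⊃⁻ B ∣⁻   = ∣ A ∣⁺ ⊃ ∣ B ∣⁻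
  ∣ ⊤⁻ ∣⁻       = ⊤′
  ∣ A ∧⁻ B ∣⁻   = ∣ A ∣⁻ ∧ ∣ B ∣⁻

data Hyp : Set where
  neg  : Neg → Hyp
  susp : Pos → Hyp          -- ⟨A⁺⟩

-- Hypothetical contexts (multisets represented as lists; all rules use
-- membership or extension, so derivability is permutation-invariant)
Ctx : Set
Ctx = List Hyp

-- Succedents of inversion / left-focus sequents (the form [A⁺] is the
-- separate right-focus judgment)
data Succ : Set where
  pos   : Pos → Succ
  negS  : Neg → Succ
  suspS : Neg → Succ        -- ⟨A⁻⟩

data Stable : Succ → Set where
  stable-pos  : ∀ {A} → Stable (pos A)
  stable-susp : ∀ {A} → Stable (suspS A)

mutual
  data RFoc (Γ : Ctx) : Pos → Set where
    id⁺  : ∀ {A} → susp A ∈ Γ → RFoc Γ A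
    ↓R   : ∀ {A} → Inv Γ [] (negS A) → RFoc Γ (↓ A)
    ∨R₁  : ∀ {A B} → RFoc Γ A → RFoc Γ (A ∨⁺ B)
    ∨R₂  : ∀ {A B} → RFoc Γ B → RFoc Γ (A ∨⁺ B)
    ⊤⁺R  : RFoc Γ ⊤⁺
    ∧⁺R  : ∀ {A B} → RFoc Γ A → RFoc Γ B → RFoc Γ (A ∧⁺ B)

  data Inv (Γ : Ctx) : List Pos → Succ → Set where
    focR : ∀ {A} → RFoc Γ A → Inv Γ [] (pos A)
    focL : ∀ {A U} → neg A ∈ Γ → Stable U → LFoc Γ A U → Inv Γ [] U
    η⁺   : ∀ {n Ω U} → Inv (susp (p⁺ n) ∷ Γ) Ω U → Inv Γ (p⁺ n ∷ Ω) U
    ↓L   : ∀ {A Ω U} → Inv (neg A ∷ Γ) Ω U → Inv Γ (↓ A ∷ Ω) U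
    ⊥L   : ∀ {Ω U} → Inv Γ (⊥⁺ ∷ Ω) U
    ∨L   : ∀ {A B Ω U} → Inv Γ (A ∷ Ω) U → Inv Γ (B ∷ Ω) U → Inv Γ (A ∨⁺ B ∷ Ω) U
    ⊤⁺L  : ∀ {Ω U} → Inv Γ Ω U → Inv Γ (⊤⁺ ∷ Ω) U
    ∧⁺L  : ∀ {A B Ω U} → Inv Γ (A ∷ B ∷ Ω) U → Inv Γ (A ∧⁺ B ∷ Ω) U
    η⁻   : ∀ {n} → Inv Γ [] (suspS (p⁻ n)) → Inv Γ [] (negS (p⁻ n))
    ↑R   : ∀ {A} → Inv Γ [] (pos A) → Inv Γ [] (negS (↑ A))
    ⊃R   : ∀ {A B} → Inv Γ (A ∷ []) (negS B) → Inv Γ [] (negS (A ⊃⁻ B))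
    ⊤⁻R  : Inv Γ [] (negS ⊤⁻)
    ∧⁻R  : ∀ {A B} → Inv Γ [] (negS A) → Inv Γ [] (negS B) → Inv Γ [] (negS (A ∧⁻ B))

  data LFoc (Γ : Ctx) : Neg → Succ → Set where
    id⁻  : ∀ {A} → LFoc Γ A (suspS A)
    ↑L   : ∀ {A U} → Stable U → Inv Γ (A ∷ []) U → LFoc Γ (↑ A) U
    ⊃L   : ∀ {A B U} → RFoc Γ A → LFoc Γ B U → LFoc Γ (A ⊃⁻ B) U
    ∧⁻L₁ : ∀ {A B U} → LFoc Γ A U → LFoc Γ (A ∧⁻ B) U
    ∧⁻L₂ : ∀ {A B U} → LFoc Γ B U → LFoc Γ (A ∧⁻ B) U

module Submission where

-- A double shift ↓↑C is invisible to erasure, and it can always be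
-- re-inserted in a proof: from Γ;· ⊢ C we get Γ;· ⊢ ↓↑C by ↑R, ↓R and
-- focR.  So the witness B is obtained from A by peeling off all leading
-- double shifts, which is the function `unshift` below.

open import Defs
open import Data.List using ([])
open import Data.Product using (Σ; _×_; _,_)
open import Relation.Binary.PropositionalEquality using (_≡_; _≢_; refl)

unshift : Pos → Pos
unshift (↓ (↑ C)) = unshift C
unshift A         = A

unshift-head : (A C : Pos) → unshift A ≢ ↓ (↑ C)
unshift-head (↓ (↑ A))      C eq = unshift-head A C eq
unshift-head (p⁺ n)         C ()
unshift-head (↓ (p⁻ n))     C ()
unshift-head (↓ (A ⊃⁻ B))   C ()
unshift-head (↓ ⊤⁻)         C ()
unshift-head (↓ (A ∧⁻ B))   C ()
unshift-head ⊥⁺             C ()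
unshift-head (A ∨⁺ B)       C ()
unshift-head ⊤⁺             C ()
unshift-head (A ∧⁺ B)       C ()

unshift-erase : (A : Pos) → ∣ unshift A ∣⁺ ≡ ∣ A ∣⁺
unshift-erase (↓ (↑ C))    = unshift-erase C
unshift-erase (p⁺ n)       = refl
unshift-erase (↓ (p⁻ n))   = refl
unshift-erase (↓ (A ⊃⁻ B)) = refl
unshift-erase (↓ ⊤⁻)       = refl
unshift-erase (↓ (A ∧⁻ B)) = refl
unshift-erase ⊥⁺           = refl
unshift-erase (A ∨⁺ B)     = refl
unshift-erase ⊤⁺           = refl
unshift-erase (A ∧⁺ B)     = refl

reshift : {Γ : Ctx} {C : Pos} → Inv Γ [] (pos C) → Inv Γ [] (pos (↓ (↑ C)))
reshift d = focR (↓R (↑R d))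

unshift-sound : (A : Pos) {Γ : Ctx} → Inv Γ [] (pos (unshift A)) → Inv Γ [] (pos A)
unshift-sound (↓ (↑ C))    d = reshift (unshift-sound C d)
unshift-sound (p⁺ n)       d = d
unshift-sound (↓ (p⁻ n))   d = d
unshift-sound (↓ (A ⊃⁻ B)) d = d
unshift-sound (↓ ⊤⁻)       d = d
unshift-sound (↓ (A ∧⁻ B)) d = d
unshift-sound ⊥⁺           d = d
unshift-sound (A ∨⁺ B)     d = d
unshift-sound ⊤⁺           d = d
unshift-sound (A ∧⁺ B)     d = d

lemma1 : (A : Pos) (P : UProp) → ∣ A ∣⁺ ≡ P →
    Σ Pos (λ B → ((C : Pos) → B ≢ ↓ (↑ C)) × (∣ B ∣⁺ ≡ P) ×
    ((Γ : Ctx) → Inv Γ [] (pos B) → Inv Γ [] (pos A)))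
lemma1 A .(∣ A ∣⁺) refl =
  unshift A , unshift-head A , unshift-erase A , λ Γ → unshift-sound A
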